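{- Let $b\ge 2$ be an integer and $Z=(x,y_1,\dots,y_b)$ indeterminates. Define polynomials $p_n(Z)$ by \[ \sum_{n=0}^\infty p_n(Z)q^n=\prod_{j=0}^\infty\left(1+xq^{b^j}\right)\left(1+y_1q^{b^j}+y_2q^{2\cdot b^j}+\cdots+y_bq^{b\cdot b^j}\right). \] Let $Q_n^b(Z)=p_{(b^{n+1}-b)/(b-1)}(Z)$ and $R_n^b(Z)=p_{(b^n-1)/(b-1)}(Z)$ for $n\ge0$, with the convention $Q_{ -1}^b(Z):=0$. Let $W_1^b(Z)=xy_{b-1}+x+y_1+y_b$, $W_2^b(Z)=x^2y_{b-1}+xy_1y_{b-1}+y_1y_b$, and let $s=\sqrt{W_2^b(Z)}$ (any fixed square root, used consistently, with $s^n=(W_2^b(Z))^{n/2}$). Then for all $n\ge0$, \begin{align*} Q_n^b(Z)&=s^n\,U_n\!\left(\frac{W_1^b(Z)}{2s}\right),\\ R_n^b(Z)&=s^n\,T_n\!\left(\frac{W_1^b(Z)}{2s}\right)+\frac{x+y_1-xy_{b-1}-y_b}{2}\,Q_{n-1}^b(Z). \end{align*}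
   Context: $T_n$ and $U_n$ are the Chebyshev polynomials of the first and second kind, defined by $\sum_{n\ge0}T_n(w)v^n=\frac{1-wv}{1-2wv+v^2}$ and $\sum_{n\ge0}U_n(w)v^n=\frac{1}{1-2wv+v^2}$. For $b=2$, $y_{b-1}=y_1$. -}

module Defs where

open import Level using (Level)
open import Algebra.Bundles using (CommutativeRing)
open import Data.Nat as ℕ using (ℕ; zero; suc; _∸_; _≤_; s≤s; z≤n; NonZero; >-nonZero)
open import Data.Nat.DivMod using (_/_)
open import Data.Bool using (if_then_else_)
open import Relation.Nullary.Decidable using (⌊_⌋)

pred-nonZero : (b : ℕ) → 2 ≤ b → NonZero (b ∸ 1)
pred-nonZero (suc (suc k)) (s≤s (s≤s _)) = _

divPred : (b : ℕ) → 2 ≤ b → ℕ → ℕ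
divPred b hb m = _/_ m (b ∸ 1) {{pred-nonZero b hb}}

module _ {c ℓ : Level} (R : CommutativeRing c ℓ) where
  open CommutativeRing R hiding (zero)

  pow : Carrier → ℕ → Carrier
  pow a zero = 1#
  pow a (suc n) = a * pow a n

  δ : ℕ → ℕ → Carrier
  δ m n = if ⌊ m ℕ.≟ n ⌋ then 1# else 0#

  sumTo : ℕ → (ℕ → Carrier) → Carrier
  sumTo zero f = f zero
  sumTo (suc n) f = sumTo n f + f (suc n)

  sum1To : ℕ → (ℕ → Carrier) → Carrier
  sum1To zero f = 0#
  sum1To (suc b) f = sum1To b f + f (suc b)

  -- formal power series in q, represented by their coefficient sequences
  Series : Set c
  Series = ℕ → Carrier

  oneS : Series
  oneS m = δ m 0

  _⊛_ : Series → Series → Series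
  (f ⊛ g) n = sumTo n (λ k → f k * g (n ∸ k))

  -- the j-th factor (1 + x q^{b^j}) (1 + y_1 q^{b^j} + ... + y_b q^{b·b^j});
  -- y i stands for y_i, only indices 1..b are used
  factor : ℕ → Carrier → (ℕ → Carrier) → ℕ → Series
  factor b x y j =
    (λ m → δ m 0 + δ m (b ℕ.^ j) * x)
    ⊛ (λ m → δ m 0 + sum1To b (λ i → δ m (i ℕ.* b ℕ.^ j) * y i))

  prodTo : ℕ → (ℕ → Series) → Series
  prodTo zero F = F zero
  prodTo (suc N) F = prodTo N F ⊛ F (suc N)

  -- p_n(Z): coefficient of q^n in ∏_{j≥0} factor j.  Factors with b^j > n
  -- are ≡ 1 modulo q^{n+1}; since b ≥ 2 we have b^j > n for j > n, so
  -- truncating the product at j = n gives the exact coefficient.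
  p : ℕ → Carrier → (ℕ → Carrier) → ℕ → Carrier
  p b x y n = prodTo n (factor b x y) n

  Q : (b : ℕ) → 2 ≤ b → Carrier → (ℕ → Carrier) → ℕ → Carrier
  Q b hb x y n = p b x y (divPred b hb (b ℕ.^ suc n ∸ b))

  Qprev : (b : ℕ) → 2 ≤ b → Carrier → (ℕ → Carrier) → ℕ → Carrier
  Qprev b hb x y zero = 0#
  Qprev b hb x y (suc n) = Q b hb x y n

  Rb : (b : ℕ) → 2 ≤ b → Carrier → (ℕ → Carrier) → ℕ → Carrier
  Rb b hb x y n = p b x y (divPred b hb (b ℕ.^ n ∸ 1))

  W₁ : ℕ → Carrier → (ℕ → Carrier) → Carrier
  W₁ b x y = x * y (b ∸ 1) + x + y 1 + y b

  W₂ : ℕ → Carrier → (ℕ → Carrier) → Carrier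
  W₂ b x y = x * x * y (b ∸ 1) + x * y 1 * y (b ∸ 1) + y 1 * y b

  -- Chebyshev polynomials (evaluated in R), via the three-term recurrence
  -- equivalent to the generating functions (1-wv)/(1-2wv+v²), 1/(1-2wv+v²)
  T : ℕ → Carrier → Carrier
  T zero w = 1#
  T (suc zero) w = w
  T (suc (suc n)) w = (1# + 1#) * w * T (suc n) w - T n w

  U : ℕ → Carrier → Carrier
  U zero w = 1#
  U (suc zero) w = (1# + 1#) * w
  U (suc (suc n)) w = (1# + 1#) * w * U (suc n) w - U n w

-- With P(q) the infinite product, P(q) = (1 + x q)(1 + y₁ q + ⋯ + y_b q^b) P(q^b). Comparing coefficients
-- at m b and at m b + 1 gives p_{(m+1)b} = p_{m+1} + β p_m and p_{mb+1} = (x + y₁) p_m + x y_b p_{m-1},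
-- where β = x y_{b-1} + y_b. Along the repunits r_{n+1} = b r_n + 1 these read Q_n = R_n + β Q_{n-1} and
-- R_{n+1} = (x + y₁) R_n + x y_b Q_{n-1}; eliminating R, Q is the Lucas sequence
-- Q_{n+2} = W₁ Q_{n+1} - W₂ Q_n with Q_0 = 1, Q_1 = W₁, which is s^n U_n(W₁/2s). The formula for R then
-- follows from U_{n+1} = T_{n+1} + w U_n. The product is handled through its truncations at j = N, whose
-- coefficient of q^m no longer changes once b^(N+1) > m.

module Submission where

open import Defs
open import Level using (Level)
open import Algebra.Bundles using (CommutativeRing)
open import Data.Nat as ℕ using (ℕ; zero; suc; _≤_; _<_; _∸_; z≤n; s≤s)
open import Data.Nat.Properties as ℕₚ using (≤-refl; m≤n⇒m≤1+n)
open import Data.Product using (_×_; _,_; proj₁; proj₂)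
open import Relation.Binary.PropositionalEquality as ≡ using (_≡_; _≢_; ≢-sym)
open import Relation.Nullary using (yes; no; ¬_)
open import Data.Empty using (⊥-elim)
open import Data.Nat.DivMod using (_/_; m*n/n≡m)
open import Data.Nat.Tactic.RingSolver using (solve-∀)
open import Data.Nat.Divisibility using (_∣_; _∣?_; ∣m+n∣m⇒∣n; n∣m*n; >⇒∤; ∣m∣n⇒∣m+n)
open import Relation.Binary.Definitions using (tri<; tri≈; tri>)

∣∸∧∣∸⇒∣∸ : ∀ {d n i j} → i ≤ j → j ≤ n → d ∣ n ∸ i → d ∣ n ∸ j → d ∣ j ∸ i
∣∸∧∣∸⇒∣∸ {d} {n} {i} {j} i≤j j≤n d∣n∸i d∣n∸j = ∣m+n∣m⇒∣n (≡.subst (d ∣_) n∸i≡n∸j+j∸i d∣n∸i) d∣n∸j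
  where
  n∸i≡n∸j+j∸i : n ∸ i ≡ n ∸ j ℕ.+ (j ∸ i)
  n∸i≡n∸j+j∸i = ≡.trans (≡.cong (_∸ i) (≡.sym (ℕₚ.m∸n+n≡m j≤n))) (ℕₚ.+-∸-assoc (n ∸ j) i≤j)

∣∸-<-absurd : ∀ {d n i j} → 1 ≤ i → i < j → j ≤ d → j ≤ n → d ∣ n ∸ i → ¬ (d ∣ n ∸ j)
∣∸-<-absurd 1≤i i<j j≤d j≤n d∣n∸i d∣n∸j =
  >⇒∤ ⦃ ℕ.>-nonZero (ℕₚ.m<n⇒0<n∸m i<j) ⦄ (ℕₚ.<-≤-trans (ℕₚ.∸-monoʳ-< 1≤i (ℕₚ.<⇒≤ i<j)) j≤d)
      (∣∸∧∣∸⇒∣∸ (ℕₚ.<⇒≤ i<j) j≤n d∣n∸i d∣n∸j)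

∣∸-injective : ∀ {d n i j} → 1 ≤ i → i ≤ d → 1 ≤ j → j ≤ d → i ≤ n → j ≤ n →
               d ∣ n ∸ i → d ∣ n ∸ j → i ≡ j
∣∸-injective {i = i} {j} 1≤i i≤d 1≤j j≤d i≤n j≤n d∣n∸i d∣n∸j with ℕₚ.<-cmp i j
... | tri< i<j _ _ = ⊥-elim (∣∸-<-absurd 1≤i i<j j≤d j≤n d∣n∸i d∣n∸j)
... | tri≈ _ i≡j _ = i≡j
... | tri> _ _ j<i = ⊥-elim (∣∸-<-absurd 1≤j j<i i≤d i≤n d∣n∸j d∣n∸i)

module FiniteSums {c ℓ : Level} (R : CommutativeRing c ℓ) where
  open CommutativeRing R hiding (zero)
  open import Relation.Binary.Reasoning.Setoid setoid
  open import Algebra.Properties.CommutativeSemigroup +-commutativeSemigroup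
    using () renaming (interchange to +-interchange)

  δ-refl : ∀ n → δ R n n ≡ 1#
  δ-refl n with n ℕ.≟ n
  ... | yes _ = ≡.refl
  ... | no n≢n = ⊥-elim (n≢n ≡.refl)

  δ-≢ : ∀ {m n} → m ≢ n → δ R m n ≡ 0#
  δ-≢ {m} {n} m≢n with m ℕ.≟ n
  ... | yes m≡n = ⊥-elim (m≢n m≡n)
  ... | no _ = ≡.refl

  δ-resp : ∀ {m n m′ n′} → (m ≡ n → m′ ≡ n′) → (m′ ≡ n′ → m ≡ n) → δ R m n ≡ δ R m′ n′
  δ-resp {m} {n} {m′} {n′} to from with m ℕ.≟ n | m′ ℕ.≟ n′
  ... | yes _ | yes _ = ≡.refl
  ... | no _ | no _ = ≡.refl
  ... | yes e | no ne = ⊥-elim (ne (to e))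
  ... | no ne | yes e = ⊥-elim (ne (from e))

  δ-≢-* : ∀ {m n} → m ≢ n → ∀ a → δ R m n * a ≈ 0#
  δ-≢-* m≢n a = trans (*-congʳ (reflexive (δ-≢ m≢n))) (zeroˡ a)

  sumTo-cong : ∀ n {f g : ℕ → Carrier} → (∀ i → i ≤ n → f i ≈ g i) → sumTo R n f ≈ sumTo R n g
  sumTo-cong zero f≈g = f≈g 0 z≤n
  sumTo-cong (suc n) f≈g = +-cong (sumTo-cong n (λ i i≤n → f≈g i (m≤n⇒m≤1+n i≤n))) (f≈g (suc n) ≤-refl)

  sumTo-≡ : ∀ {m n} (f : ℕ → Carrier) → m ≡ n → sumTo R m f ≈ sumTo R n f
  sumTo-≡ f m≡n = reflexive (≡.cong (λ m → sumTo R m f) m≡n)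

  sumTo-zero : ∀ n {f : ℕ → Carrier} → (∀ i → i ≤ n → f i ≈ 0#) → sumTo R n f ≈ 0#
  sumTo-zero zero f≈0 = f≈0 0 z≤n
  sumTo-zero (suc n) f≈0 =
    trans (+-cong (sumTo-zero n (λ i i≤n → f≈0 i (m≤n⇒m≤1+n i≤n))) (f≈0 (suc n) ≤-refl)) (+-identityʳ 0#)

  sumTo-distrib-+ : ∀ n (f g : ℕ → Carrier) → sumTo R n (λ i → f i + g i) ≈ sumTo R n f + sumTo R n g
  sumTo-distrib-+ zero f g = refl
  sumTo-distrib-+ (suc n) f g =
    trans (+-congʳ (sumTo-distrib-+ n f g)) (+-interchange _ _ _ _)

  *-distribˡ-sumTo : ∀ n a (f : ℕ → Carrier) → a * sumTo R n f ≈ sumTo R n (λ i → a * f i)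
  *-distribˡ-sumTo zero a f = refl
  *-distribˡ-sumTo (suc n) a f = trans (distribˡ a _ _) (+-congʳ (*-distribˡ-sumTo n a f))

  *-distribʳ-sumTo : ∀ n a (f : ℕ → Carrier) → sumTo R n f * a ≈ sumTo R n (λ i → f i * a)
  *-distribʳ-sumTo zero a f = refl
  *-distribʳ-sumTo (suc n) a f = trans (distribʳ a _ _) (+-congʳ (*-distribʳ-sumTo n a f))

  sumTo-single : ∀ n j {f : ℕ → Carrier} → j ≤ n → (∀ i → i ≤ n → i ≢ j → f i ≈ 0#) →
                 sumTo R n f ≈ f j
  sumTo-single zero .zero z≤n _ = refl
  sumTo-single (suc n) j j≤1+n others with j ℕ.≟ suc n
  ... | yes ≡.refl = trans (+-congʳ (sumTo-zero n (λ i i≤n → others i (m≤n⇒m≤1+n i≤n) (ℕₚ.<⇒≢ (s≤s i≤n)))))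
                           (+-identityˡ _)
  ... | no j≢1+n = trans (+-cong (sumTo-single n j (ℕₚ.≤-pred (ℕₚ.≤∧≢⇒< j≤1+n j≢1+n))
                                                 (λ i i≤n → others i (m≤n⇒m≤1+n i≤n)))
                                  (others (suc n) ≤-refl (≢-sym j≢1+n)))
                         (+-identityʳ _)

  sumTo-δ : ∀ n j (f : ℕ → Carrier) → j ≤ n → sumTo R n (λ k → δ R k j * f k) ≈ f j
  sumTo-δ n j f j≤n = begin
    sumTo R n (λ k → δ R k j * f k)   ≈⟨ sumTo-single n j j≤n (λ i _ i≢j → δ-≢-* i≢j (f i)) ⟩
    δ R j j * f j                     ≈⟨ *-congʳ (reflexive (δ-refl j)) ⟩
    1# * f j                          ≈⟨ *-identityˡ (f j) ⟩
    f j                               ∎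

  sumTo-δ-zero : ∀ n j (f : ℕ → Carrier) → (j ≤ n → f j ≈ 0#) → sumTo R n (λ k → δ R k j * f k) ≈ 0#
  sumTo-δ-zero n j f fj≈0 with j ℕ.≤? n
  ... | yes j≤n = trans (sumTo-δ n j f j≤n) (fj≈0 j≤n)
  ... | no j≰n = sumTo-zero n (λ i i≤n → δ-≢-* (λ { ≡.refl → j≰n i≤n }) (f i))

  sumTo-triangle : ∀ n (a : ℕ → ℕ → Carrier) →
    sumTo R n (λ k → sumTo R k (λ i → a i k)) ≈ sumTo R n (λ i → sumTo R (n ∸ i) (λ t → a i (i ℕ.+ t)))
  sumTo-triangle zero a = refl
  sumTo-triangle (suc n) a = begin
    sumTo R n (λ k → sumTo R k (λ i → a i k)) + sumTo R (suc n) (λ i → a i (suc n))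
      ≈⟨ +-congʳ (sumTo-triangle n a) ⟩
    rows n + (sumTo R n (λ i → a i (suc n)) + a (suc n) (suc n))
      ≈⟨ +-assoc _ _ _ ⟨
    (rows n + sumTo R n (λ i → a i (suc n))) + a (suc n) (suc n)
      ≈⟨ +-cong (sumTo-distrib-+ n _ _) last-row ⟨
    sumTo R n (λ i → row n i + a i (suc n)) + row (suc n) (suc n)
      ≈⟨ +-congʳ (sumTo-cong n extend-row) ⟩
    rows (suc n)
      ∎
    where
    row : ℕ → ℕ → Carrier
    row n i = sumTo R (n ∸ i) (λ t → a i (i ℕ.+ t))
    rows : ℕ → Carrier
    rows n = sumTo R n (row n)
    last-row : row (suc n) (suc n) ≈ a (suc n) (suc n)
    last-row = trans (sumTo-≡ _ (ℕₚ.n∸n≡0 n)) (reflexive (≡.cong (a (suc n)) (ℕₚ.+-identityʳ (suc n))))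
    extend-row : ∀ i → i ≤ n → row n i + a i (suc n) ≈ row (suc n) i
    extend-row i i≤n = sym (trans (sumTo-≡ _ (ℕₚ.+-∸-assoc 1 i≤n))
      (+-congˡ (reflexive (≡.cong (a i) (≡.trans (ℕₚ.+-suc i (n ∸ i)) (≡.cong suc (ℕₚ.m+[n∸m]≡n i≤n)))))))

  sum1To-cong : ∀ m {f g : ℕ → Carrier} → (∀ i → 1 ≤ i → i ≤ m → f i ≈ g i) → sum1To R m f ≈ sum1To R m g
  sum1To-cong zero f≈g = refl
  sum1To-cong (suc m) f≈g =
    +-cong (sum1To-cong m (λ i 1≤i i≤m → f≈g i 1≤i (m≤n⇒m≤1+n i≤m))) (f≈g (suc m) (s≤s z≤n) ≤-refl)

  sum1To-zero : ∀ m {f : ℕ → Carrier} → (∀ i → 1 ≤ i → i ≤ m → f i ≈ 0#) → sum1To R m f ≈ 0#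
  sum1To-zero zero f≈0 = refl
  sum1To-zero (suc m) f≈0 =
    trans (+-cong (sum1To-zero m (λ i 1≤i i≤m → f≈0 i 1≤i (m≤n⇒m≤1+n i≤m))) (f≈0 (suc m) (s≤s z≤n) ≤-refl))
          (+-identityʳ 0#)

  sum1To-single : ∀ m j {f : ℕ → Carrier} → 1 ≤ j → j ≤ m → (∀ i → 1 ≤ i → i ≤ m → i ≢ j → f i ≈ 0#) →
                  sum1To R m f ≈ f j
  sum1To-single zero j 1≤j j≤0 _ = ⊥-elim (ℕₚ.<⇒≱ 1≤j j≤0)
  sum1To-single (suc m) j 1≤j j≤1+m others with j ℕ.≟ suc m
  ... | yes ≡.refl = trans (+-congʳ (sum1To-zero m (λ i 1≤i i≤m → others i 1≤i (m≤n⇒m≤1+n i≤m) (ℕₚ.<⇒≢ (s≤s i≤m)))))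
                           (+-identityˡ _)
  ... | no j≢1+m = trans (+-cong (sum1To-single m j 1≤j (ℕₚ.≤-pred (ℕₚ.≤∧≢⇒< j≤1+m j≢1+m))
                                                   (λ i 1≤i i≤m → others i 1≤i (m≤n⇒m≤1+n i≤m)))
                                  (others (suc m) (s≤s z≤n) ≤-refl (≢-sym j≢1+m)))
                         (+-identityʳ _)

  *-distribʳ-sum1To : ∀ m a (f : ℕ → Carrier) → sum1To R m f * a ≈ sum1To R m (λ i → f i * a)
  *-distribʳ-sum1To zero a f = zeroˡ a
  *-distribʳ-sum1To (suc m) a f = trans (distribʳ a _ _) (+-congʳ (*-distribʳ-sum1To m a f))

  sumTo-sum1To-comm : ∀ n m (a : ℕ → ℕ → Carrier) →
    sumTo R n (λ k → sum1To R m (a k)) ≈ sum1To R m (λ i → sumTo R n (λ k → a k i))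
  sumTo-sum1To-comm n zero a = sumTo-zero n (λ _ _ → refl)
  sumTo-sum1To-comm n (suc m) a = trans (sumTo-distrib-+ n _ _) (+-congʳ (sumTo-sum1To-comm n m a))

module PowerSeries {c ℓ : Level} (R : CommutativeRing c ℓ) where
  open CommutativeRing R hiding (zero)
  open FiniteSums R
  open import Relation.Binary.Reasoning.Setoid setoid

  infixl 7 _⋆_
  _⋆_ : Series R → Series R → Series R
  _⋆_ = _⊛_ R

  ⋆-cong-≤ : ∀ n {f f′ g g′ : Series R} → (∀ k → k ≤ n → f k ≈ f′ k) → (∀ k → k ≤ n → g k ≈ g′ k) →
             (f ⋆ g) n ≈ (f′ ⋆ g′) n
  ⋆-cong-≤ n f≈f′ g≈g′ = sumTo-cong n (λ k k≤n → *-cong (f≈f′ k k≤n) (g≈g′ (n ∸ k) (ℕₚ.m∸n≤m n k)))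

  ⋆-assoc : ∀ (f g h : Series R) n → ((f ⋆ g) ⋆ h) n ≈ (f ⋆ (g ⋆ h)) n
  ⋆-assoc f g h n = begin
    sumTo R n (λ k → sumTo R k (λ i → f i * g (k ∸ i)) * h (n ∸ k))
      ≈⟨ sumTo-cong n (λ k _ → *-distribʳ-sumTo k _ _) ⟩
    sumTo R n (λ k → sumTo R k (λ i → f i * g (k ∸ i) * h (n ∸ k)))
      ≈⟨ sumTo-triangle n (λ i k → f i * g (k ∸ i) * h (n ∸ k)) ⟩
    sumTo R n (λ i → sumTo R (n ∸ i) (λ t → f i * g (i ℕ.+ t ∸ i) * h (n ∸ (i ℕ.+ t))))
      ≈⟨ sumTo-cong n (λ i _ → sumTo-cong (n ∸ i) (λ t _ → trans (*-assoc _ _ _) (*-congˡ (*-cong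
           (reflexive (≡.cong g (ℕₚ.m+n∸m≡n i t))) (reflexive (≡.cong h (≡.sym (ℕₚ.∸-+-assoc n i t)))))))) ⟩
    sumTo R n (λ i → sumTo R (n ∸ i) (λ t → f i * (g t * h (n ∸ i ∸ t))))
      ≈⟨ sumTo-cong n (λ i _ → *-distribˡ-sumTo (n ∸ i) _ _) ⟨
    sumTo R n (λ i → f i * sumTo R (n ∸ i) (λ t → g t * h (n ∸ i ∸ t)))
      ∎

  ⋆-identityʳ : ∀ (f : Series R) n → (f ⋆ oneS R) n ≈ f n
  ⋆-identityʳ f n = begin
    sumTo R n (λ k → f k * δ R (n ∸ k) 0)
      ≈⟨ sumTo-single n n ≤-refl (λ k k≤n k≢n → trans (*-comm _ _)
           (δ-≢-* (ℕₚ.m>n⇒m∸n≢0 (ℕₚ.≤∧≢⇒< k≤n k≢n)) (f k))) ⟩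
    f n * δ R (n ∸ n) 0
      ≈⟨ *-congˡ (reflexive (≡.trans (≡.cong (λ m → δ R m 0) (ℕₚ.n∸n≡0 n)) (δ-refl 0))) ⟩
    f n * 1#
      ≈⟨ *-identityʳ (f n) ⟩
    f n
      ∎

  infix 8 q·_
  q·_ : Series R → Series R
  (q· f) zero = 0#
  (q· f) (suc m) = f m

  linear : Carrier → Series R
  linear x m = δ R m 0 + δ R m 1 * x

  linear-⋆ : ∀ x (h : Series R) n → (linear x ⋆ h) n ≈ h n + x * (q· h) n
  linear-⋆ x h zero = trans (*-congʳ (trans (+-congˡ (zeroˡ x)) (+-identityʳ 1#)))
                            (trans (*-identityˡ _) (sym (trans (+-congˡ (zeroʳ x)) (+-identityʳ _))))
  linear-⋆ x h (suc n) = begin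
    sumTo R (suc n) (λ k → (δ R k 0 + δ R k 1 * x) * h (suc n ∸ k))
      ≈⟨ sumTo-cong (suc n) (λ k _ → trans (distribʳ _ _ _) (+-congˡ (*-assoc _ _ _))) ⟩
    sumTo R (suc n) (λ k → δ R k 0 * h (suc n ∸ k) + δ R k 1 * (x * h (suc n ∸ k)))
      ≈⟨ sumTo-distrib-+ (suc n) _ _ ⟩
    sumTo R (suc n) (λ k → δ R k 0 * h (suc n ∸ k)) + sumTo R (suc n) (λ k → δ R k 1 * (x * h (suc n ∸ k)))
      ≈⟨ +-cong (sumTo-δ (suc n) 0 _ z≤n) (sumTo-δ (suc n) 1 _ (s≤s z≤n)) ⟩
    h (suc n) + x * h n
      ∎

  module Dilation (b₀ : ℕ) where
    b : ℕ
    b = suc b₀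

    -- G(q) = g(q^b)
    IsDilation : Series R → Series R → Set ℓ
    IsDilation G g = (∀ i → G (i ℕ.* b) ≈ g i) × (∀ n → ¬ (b ∣ n) → G n ≈ 0#)

    ∤-r+q*b : ∀ r q → 0 < r → r < b → ¬ (b ∣ r ℕ.+ q ℕ.* b)
    ∤-r+q*b r q 0<r r<b b∣r+qb = >⇒∤ ⦃ ℕ.>-nonZero 0<r ⦄ r<b
      (∣m+n∣m⇒∣n (≡.subst (b ∣_) (ℕₚ.+-comm r (q ℕ.* b)) b∣r+qb) (n∣m*n q))

    sumTo-+-zeros : ∀ t m (a : ℕ → Carrier) → (∀ s → s < t → a (suc (s ℕ.+ m)) ≈ 0#) →
                    sumTo R (t ℕ.+ m) a ≈ sumTo R m a
    sumTo-+-zeros zero m a _ = refl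
    sumTo-+-zeros (suc t) m a zeros =
      trans (+-cong (sumTo-+-zeros t m a (λ s s<t → zeros s (m≤n⇒m≤1+n s<t))) (zeros t ≤-refl)) (+-identityʳ _)

    sumTo-multiples : ∀ i (a : ℕ → Carrier) → (∀ k → ¬ (b ∣ k) → a k ≈ 0#) →
                      sumTo R (i ℕ.* b) a ≈ sumTo R i (λ j → a (j ℕ.* b))
    sumTo-multiples zero a _ = refl
    sumTo-multiples (suc i) a zeros = +-congʳ (begin
      sumTo R (b₀ ℕ.+ i ℕ.* b) a
        ≈⟨ sumTo-+-zeros b₀ (i ℕ.* b) a (λ s s<b₀ → zeros _ (∤-r+q*b (suc s) i (s≤s z≤n) (s≤s s<b₀))) ⟩
      sumTo R (i ℕ.* b) a
        ≈⟨ sumTo-multiples i a zeros ⟩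
      sumTo R i (λ j → a (j ℕ.* b))
        ∎)

    isDilation-cong : ∀ {G G′ g} → (∀ n → G n ≈ G′ n) → IsDilation G g → IsDilation G′ g
    isDilation-cong G≈G′ (at-mult , off) =
      (λ i → trans (sym (G≈G′ (i ℕ.* b))) (at-mult i)) , (λ n b∤n → trans (sym (G≈G′ n)) (off n b∤n))

    +-isDilation : ∀ {G g H h} → IsDilation G g → IsDilation H h →
                   IsDilation (λ n → G n + H n) (λ n → g n + h n)
    +-isDilation (G-at-mult , G-off) (H-at-mult , H-off) =
      (λ i → +-cong (G-at-mult i) (H-at-mult i)) ,
      (λ n b∤n → trans (+-cong (G-off n b∤n) (H-off n b∤n)) (+-identityʳ 0#))

    *ʳ-isDilation : ∀ {G g} a → IsDilation G g → IsDilation (λ n → G n * a) (λ n → g n * a)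
    *ʳ-isDilation a (at-mult , off) = (λ i → *-congʳ (at-mult i)) , (λ n b∤n → trans (*-congʳ (off n b∤n)) (zeroˡ a))

    sum1To-isDilation : ∀ m {G g : ℕ → Series R} → (∀ i → IsDilation (G i) (g i)) →
                        IsDilation (λ n → sum1To R m (λ i → G i n)) (λ n → sum1To R m (λ i → g i n))
    sum1To-isDilation zero _ = (λ _ → refl) , (λ _ _ → refl)
    sum1To-isDilation (suc m) dil = +-isDilation (sum1To-isDilation m dil) (dil (suc m))

    ⋆-isDilation : ∀ {G g H h} → IsDilation G g → IsDilation H h → IsDilation (G ⋆ H) (g ⋆ h)
    ⋆-isDilation {G} {g} {H} {h} (G-at-mult , G-off) (H-at-mult , H-off) = at-mult , off
      where
      at-mult : ∀ i → (G ⋆ H) (i ℕ.* b) ≈ (g ⋆ h) i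
      at-mult i = trans (sumTo-multiples i _ (λ k b∤k → trans (*-congʳ (G-off k b∤k)) (zeroˡ _)))
        (sumTo-cong i (λ j _ → *-cong (G-at-mult j)
          (trans (reflexive (≡.cong H (≡.sym (ℕₚ.*-distribʳ-∸ b i j)))) (H-at-mult (i ∸ j)))))
      off : ∀ n → ¬ (b ∣ n) → (G ⋆ H) n ≈ 0#
      off n b∤n = sumTo-zero n term
        where
        term : ∀ k → k ≤ n → G k * H (n ∸ k) ≈ 0#
        term k k≤n with b ∣? k
        ... | yes b∣k = trans (*-congˡ (H-off (n ∸ k) (λ b∣n-k →
                          b∤n (≡.subst (b ∣_) (ℕₚ.m∸n+n≡m k≤n) (∣m∣n⇒∣m+n b∣n-k b∣k))))) (zeroʳ _)
        ... | no b∤k = trans (*-congʳ (G-off k b∤k)) (zeroˡ _)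

module Lucas {c ℓ : Level} (R : CommutativeRing c ℓ) where
  open CommutativeRing R hiding (zero)
  open import Relation.Binary.Reasoning.Setoid setoid
  open import Algebra.Properties.Group +-group using (∙-cancelʳ; //-rightDividesˡ)
  open import Algebra.Solver.Ring.NaturalCoefficients.Default commutativeSemiring
    using (solve; _:=_; _:+_; _:*_; con)
  open PowerSeries R using (q·_)

  -- a (n + 2) = P * a (n + 1) - Q * a n, stated without subtraction
  LucasRecurrence : Carrier → Carrier → (ℕ → Carrier) → Set ℓ
  LucasRecurrence P Q a = ∀ n → a (suc (suc n)) + Q * a n ≈ P * a (suc n)

  lucas-unique : ∀ {P Q a a′} → LucasRecurrence P Q a → LucasRecurrence P Q a′ →
                 a 0 ≈ a′ 0 → a 1 ≈ a′ 1 → ∀ n → a n ≈ a′ n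
  lucas-unique {P} {Q} {a} {a′} rec rec′ a₀ a₁ n = proj₁ (consecutive n)
    where
    consecutive : ∀ n → (a n ≈ a′ n) × (a (suc n) ≈ a′ (suc n))
    consecutive zero = a₀ , a₁
    consecutive (suc n) with consecutive n
    ... | aₙ , aₙ₊₁ = aₙ₊₁ , ∙-cancelʳ (Q * a n) _ _ (begin
      a (suc (suc n)) + Q * a n     ≈⟨ rec n ⟩
      P * a (suc n)                 ≈⟨ *-congˡ aₙ₊₁ ⟩
      P * a′ (suc n)                ≈⟨ rec′ n ⟨
      a′ (suc (suc n)) + Q * a′ n   ≈⟨ +-congˡ (*-congˡ aₙ) ⟨
      a′ (suc (suc n)) + Q * a n    ∎)

  lucas-resp : ∀ {P P′ Q Q′ a} → P ≈ P′ → Q ≈ Q′ → LucasRecurrence P Q a → LucasRecurrence P′ Q′ a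
  lucas-resp P≈P′ Q≈Q′ rec n = trans (+-congˡ (*-congʳ (sym Q≈Q′))) (trans (rec n) (*-congʳ P≈P′))

  lucas-suc : ∀ {P Q a} → LucasRecurrence P Q a → LucasRecurrence P Q (λ n → a (suc n))
  lucas-suc rec n = rec (suc n)

  lucas-+ : ∀ {P Q a a′} → LucasRecurrence P Q a → LucasRecurrence P Q a′ →
            LucasRecurrence P Q (λ n → a n + a′ n)
  lucas-+ {P} {Q} {a} {a′} rec rec′ n = begin
    (a (suc (suc n)) + a′ (suc (suc n))) + Q * (a n + a′ n)
      ≈⟨ solve 5 (λ a₂ a₂′ Q a₀ a₀′ → (a₂ :+ a₂′) :+ Q :* (a₀ :+ a₀′) := (a₂ :+ Q :* a₀) :+ (a₂′ :+ Q :* a₀′))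
           refl (a (suc (suc n))) (a′ (suc (suc n))) Q (a n) (a′ n) ⟩
    (a (suc (suc n)) + Q * a n) + (a′ (suc (suc n)) + Q * a′ n)
      ≈⟨ +-cong (rec n) (rec′ n) ⟩
    P * a (suc n) + P * a′ (suc n)
      ≈⟨ distribˡ P _ _ ⟨
    P * (a (suc n) + a′ (suc n))
      ∎

  lucas-*ˡ : ∀ {P Q a} k → LucasRecurrence P Q a → LucasRecurrence P Q (λ n → k * a n)
  lucas-*ˡ {P} {Q} {a} k rec n = begin
    k * a (suc (suc n)) + Q * (k * a n)   ≈⟨ solve 4 (λ k a₂ Q a₀ → k :* a₂ :+ Q :* (k :* a₀) := k :* (a₂ :+ Q :* a₀))
                                               refl k (a (suc (suc n))) Q (a n) ⟩
    k * (a (suc (suc n)) + Q * a n)       ≈⟨ *-congˡ (rec n) ⟩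
    k * (P * a (suc n))                   ≈⟨ x∙yz≈y∙xz k P _ ⟩
    P * (k * a (suc n))                   ∎
    where open import Algebra.Properties.CommutativeSemigroup *-commutativeSemigroup using (x∙yz≈y∙xz)

  lucas-scale : ∀ {P Q a} s → LucasRecurrence P Q a → LucasRecurrence (s * P) (s * s * Q) (λ n → pow R s n * a n)
  lucas-scale {P} {Q} {a} s rec n = begin
    s * (s * sⁿ) * a (suc (suc n)) + s * s * Q * (sⁿ * a n)
      ≈⟨ solve 5 (λ s sⁿ a₂ Q a₀ → s :* (s :* sⁿ) :* a₂ :+ s :* s :* Q :* (sⁿ :* a₀) := s :* (s :* sⁿ) :* (a₂ :+ Q :* a₀))
           refl s sⁿ (a (suc (suc n))) Q (a n) ⟩
    s * (s * sⁿ) * (a (suc (suc n)) + Q * a n)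
      ≈⟨ *-congˡ (rec n) ⟩
    s * (s * sⁿ) * (P * a (suc n))
      ≈⟨ solve 4 (λ s sⁿ P a₁ → s :* (s :* sⁿ) :* (P :* a₁) := s :* P :* (s :* sⁿ :* a₁)) refl s sⁿ P (a (suc n)) ⟩
    s * P * (s * sⁿ * a (suc n))
      ∎
    where sⁿ = pow R s n

  lucas-from-minus : ∀ P (a : ℕ → Carrier) → (∀ n → a (suc (suc n)) ≡ P * a (suc n) - a n) → LucasRecurrence P 1# a
  lucas-from-minus P a def n = trans (+-cong (reflexive (def n)) (*-identityˡ (a n))) (//-rightDividesˡ (a n) _)

  T-lucas : ∀ w → LucasRecurrence ((1# + 1#) * w) 1# (λ n → T R n w)
  T-lucas w = lucas-from-minus _ _ (λ _ → ≡.refl)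

  U-lucas : ∀ w → LucasRecurrence ((1# + 1#) * w) 1# (λ n → U R n w)
  U-lucas w = lucas-from-minus _ _ (λ _ → ≡.refl)

  T+wU≈U : ∀ w n → T R (suc n) w + w * U R n w ≈ U R (suc n) w
  T+wU≈U w = lucas-unique (lucas-+ (lucas-suc (T-lucas w)) (lucas-*ˡ w (U-lucas w))) (lucas-suc (U-lucas w))
    (solve 1 (λ w → w :+ w :* con 1 := con 2 :* w) refl w)
    (solve 2 (λ w m → (con 2 :* w :* w :+ m) :+ w :* (con 2 :* w) := con 2 :* w :* (con 2 :* w) :+ m) refl w (- 1#))

  module _ {P Q : Carrier} (s inv2s : Carrier) (s²≈Q : s * s ≈ Q) (inv2s-inverse : inv2s * ((1# + 1#) * s) ≈ 1#) where
    s·2w≈P : s * ((1# + 1#) * (P * inv2s)) ≈ P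
    s·2w≈P = trans (solve 3 (λ s P i → s :* (con 2 :* (P :* i)) := (i :* (con 2 :* s)) :* P) refl s P inv2s)
                   (trans (*-congʳ inv2s-inverse) (*-identityˡ P))

    lucas-closed-form-U : ∀ {a} → LucasRecurrence P Q a → a 0 ≈ 1# → a 1 ≈ P →
                          ∀ n → a n ≈ pow R s n * U R n (P * inv2s)
    lucas-closed-form-U rec a₀ a₁ = lucas-unique rec
      (lucas-resp s·2w≈P (trans (*-identityʳ _) s²≈Q) (lucas-scale s (U-lucas (P * inv2s))))
      (trans a₀ (sym (*-identityʳ 1#)))
      (trans a₁ (sym (trans (*-congʳ (*-identityʳ s)) s·2w≈P)))

    module _ (half : Carrier) (half-inverse : half * (1# + 1#) ≈ 1#) where
      s·w≈P·half : s * (P * inv2s) ≈ P * half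
      s·w≈P·half = begin
        s * (P * inv2s)                         ≈⟨ *-identityʳ _ ⟨
        s * (P * inv2s) * 1#                    ≈⟨ *-congˡ half-inverse ⟨
        s * (P * inv2s) * (half * (1# + 1#))    ≈⟨ solve 4 (λ s P i h → s :* (P :* i) :* (h :* con 2) := P :* h :* (i :* (con 2 :* s)))
                                                     refl s P inv2s half ⟩
        P * half * (inv2s * ((1# + 1#) * s))    ≈⟨ *-congˡ inv2s-inverse ⟩
        P * half * 1#                           ≈⟨ *-identityʳ _ ⟩
        P * half                                ∎

      -- U (n + 1) = T (n + 1) + w U n, scaled by s^(n+1)
      lucas-closed-form-T : ∀ {a} → LucasRecurrence P Q a → a 0 ≈ 1# → a 1 ≈ P →
                            ∀ n → a n ≈ pow R s n * T R n (P * inv2s) + P * half * (q· a) n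
      lucas-closed-form-T rec a₀ a₁ zero = trans a₀ (sym (trans (+-cong (*-identityʳ 1#) (zeroʳ _)) (+-identityʳ 1#)))
      lucas-closed-form-T {a} rec a₀ a₁ (suc n) = begin
        a (suc n)
          ≈⟨ closed-form-U (suc n) ⟩
        s * sⁿ * U R (suc n) w
          ≈⟨ *-congˡ (T+wU≈U w n) ⟨
        s * sⁿ * (T R (suc n) w + w * U R n w)
          ≈⟨ solve 5 (λ s sⁿ Tₙ₊₁ w Uₙ → s :* sⁿ :* (Tₙ₊₁ :+ w :* Uₙ) := s :* sⁿ :* Tₙ₊₁ :+ s :* w :* (sⁿ :* Uₙ))
               refl s sⁿ (T R (suc n) w) w (U R n w) ⟩
        s * sⁿ * T R (suc n) w + s * w * (sⁿ * U R n w)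
          ≈⟨ +-congˡ (*-cong s·w≈P·half (sym (closed-form-U n))) ⟩
        s * sⁿ * T R (suc n) w + P * half * a n
          ∎
        where
        w = P * inv2s
        sⁿ = pow R s n
        closed-form-U = lucas-closed-form-U rec a₀ a₁

module _ {c ℓ : Level} (R : CommutativeRing c ℓ) where
  open CommutativeRing R
  open import Algebra.Properties.Group +-group using (//-rightDividesˡ)
  open import Algebra.Solver.Ring.NaturalCoefficients.Default commutativeSemiring
    using (solve; _:=_; _:+_; _:*_; con)

  [a-c]·half+c≈[a+c]·half : ∀ half → half * (1# + 1#) ≈ 1# → ∀ a c → (a - c) * half + c ≈ (a + c) * half
  [a-c]·half+c≈[a+c]·half half half-inverse a c = begin
    (a - c) * half + c                          ≈⟨ +-congˡ (trans (*-congˡ half-inverse) (*-identityʳ c)) ⟨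
    (a - c) * half + c * (half * (1# + 1#))     ≈⟨ solve 3 (λ d c h → d :* h :+ c :* (h :* con 2) := (d :+ c) :* h :+ c :* h)
                                                     refl (a - c) c half ⟩
    ((a - c) + c) * half + c * half             ≈⟨ +-congʳ (*-congʳ (//-rightDividesˡ c a)) ⟩
    a * half + c * half                         ≈⟨ distribʳ half a c ⟨
    (a + c) * half                              ∎
    where open import Relation.Binary.Reasoning.Setoid setoid

module GeneratingProduct {c ℓ : Level} (R : CommutativeRing c ℓ) where
  open CommutativeRing R hiding (zero)
  open import Relation.Binary.Reasoning.Setoid setoid
  open FiniteSums R
  open PowerSeries R
  open Lucas R using (LucasRecurrence)
  open import Algebra.Properties.AbelianGroup +-abelianGroup using (⁻¹-∙-comm)
  open import Algebra.Solver.Ring.NaturalCoefficients.Default commutativeSemiring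
    using (solve; _:=_; _:+_; _:*_; con)

  module Product (k : ℕ) (x : Carrier) (y : ℕ → Carrier) where
    open Dilation (suc k)

    F : ℕ → Series R
    F = factor R b x y

    A : ℕ → Series R
    A j m = δ R m 0 + δ R m (b ℕ.^ j) * x

    B : ℕ → Series R
    B j m = δ R m 0 + sum1To R b (λ i → δ R m (i ℕ.* b ℕ.^ j) * y i)

    δ-*b : ∀ i m → δ R (i ℕ.* b) (m ℕ.* b) ≡ δ R i m
    δ-*b i m = δ-resp (ℕₚ.*-cancelʳ-≡ i m b) (≡.cong (ℕ._* b))

    δ-∤ : ∀ {n m} → ¬ (b ∣ n) → b ∣ m → δ R n m ≡ 0#
    δ-∤ b∤n b∣m = δ-≢ (λ { ≡.refl → b∤n b∣m })

    *b^[1+j] : ∀ i j → i ℕ.* b ℕ.^ suc j ≡ i ℕ.* b ℕ.^ j ℕ.* b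
    *b^[1+j] i j = ≡.trans (≡.cong (i ℕ.*_) (ℕₚ.*-comm b (b ℕ.^ j))) (≡.sym (ℕₚ.*-assoc i (b ℕ.^ j) b))

    δ-dilation : ∀ e → IsDilation (λ m → δ R m (e ℕ.* b)) (λ m → δ R m e)
    δ-dilation e = (λ i → reflexive (δ-*b i e)) , (λ n b∤n → reflexive (δ-∤ b∤n (n∣m*n e)))

    A-isDilation : ∀ j → IsDilation (A (suc j)) (A j)
    A-isDilation j = isDilation-cong (λ m → +-congˡ (*-congʳ (reflexive (≡.cong (δ R m) (ℕₚ.*-comm (b ℕ.^ j) b)))))
      (+-isDilation (δ-dilation 0) (*ʳ-isDilation x (δ-dilation (b ℕ.^ j))))

    B-isDilation : ∀ j → IsDilation (B (suc j)) (B j)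
    B-isDilation j = isDilation-cong
      (λ m → +-congˡ (sum1To-cong b (λ i _ _ → *-congʳ (reflexive (≡.cong (δ R m) (≡.sym (*b^[1+j] i j)))))))
      (+-isDilation (δ-dilation 0) (sum1To-isDilation b (λ i → *ʳ-isDilation (y i) (δ-dilation (i ℕ.* b ℕ.^ j)))))

    F-isDilation : ∀ j → IsDilation (F (suc j)) (F j)
    F-isDilation j = ⋆-isDilation (A-isDilation j) (B-isDilation j)

    P : ℕ → Series R
    P N = prodTo R N F

    -- the product of the factors 1, …, N + 1, i.e. P N (q^b)
    P∘q^b : ℕ → Series R
    P∘q^b N = prodTo R N (λ j → F (suc j))

    P∘q^b-isDilation : ∀ N → IsDilation (P∘q^b N) (P N)
    P∘q^b-isDilation zero = F-isDilation 0
    P∘q^b-isDilation (suc N) = ⋆-isDilation (P∘q^b-isDilation N) (F-isDilation (suc N))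

    P-suc : ∀ N n → P (suc N) n ≈ (linear x ⋆ (B 0 ⋆ P∘q^b N)) n
    P-suc N n = trans (split N n) (⋆-assoc (linear x) (B 0) (P∘q^b N) n)
      where
      split : ∀ N n → P (suc N) n ≈ (F 0 ⋆ P∘q^b N) n
      split zero n = refl
      split (suc N) n = trans (⋆-cong-≤ n {g = F (suc (suc N))} (λ m _ → split N m) (λ _ _ → refl))
                              (⋆-assoc (F 0) (P∘q^b N) (F (suc (suc N))) n)

    n<b^n : ∀ n → n < b ℕ.^ n
    n<b^n zero = s≤s z≤n
    n<b^n (suc n) = ℕₚ.≤-<-trans (n<b^n n) (ℕₚ.^-monoʳ-< b (s≤s (s≤s z≤n)) (ℕₚ.n<1+n n))

    F-trivial : ∀ j t → t < b ℕ.^ j → F j t ≈ oneS R t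
    F-trivial j t t<b^j = trans (⋆-cong-≤ t A-trivial B-trivial) (⋆-identityʳ (oneS R) t)
      where
      A-trivial : ∀ m → m ≤ t → A j m ≈ δ R m 0
      A-trivial m m≤t = trans (+-congˡ (δ-≢-* (ℕₚ.<⇒≢ (ℕₚ.≤-<-trans m≤t t<b^j)) x)) (+-identityʳ _)
      B-trivial : ∀ m → m ≤ t → B j m ≈ δ R m 0
      B-trivial m m≤t = trans (+-congˡ (sum1To-zero b term)) (+-identityʳ _)
        where
        term : ∀ i → 1 ≤ i → i ≤ b → δ R m (i ℕ.* b ℕ.^ j) * y i ≈ 0#
        term (suc i) _ _ = δ-≢-* (ℕₚ.<⇒≢ (ℕₚ.≤-<-trans m≤t (ℕₚ.<-≤-trans t<b^j (ℕₚ.m≤n*m (b ℕ.^ j) (suc i))))) (y (suc i))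

    P-suc-stable : ∀ N m → m < b ℕ.^ suc N → P (suc N) m ≈ P N m
    P-suc-stable N m m<b^[1+N] =
      trans (⋆-cong-≤ m (λ _ _ → refl) (λ t t≤m → F-trivial (suc N) t (ℕₚ.≤-<-trans t≤m m<b^[1+N])))
            (⋆-identityʳ (P N) m)

    P-stable : ∀ N m → m ≤ N → P N m ≈ p R b x y m
    P-stable N m m≤N = trans (reflexive (≡.cong (λ N → P N m) (≡.sym (ℕₚ.m∸n+n≡m m≤N)))) (stable (N ∸ m))
      where
      stable : ∀ e → P (e ℕ.+ m) m ≈ P m m
      stable zero = refl
      stable (suc e) = trans (P-suc-stable (e ℕ.+ m) m
        (ℕₚ.<-≤-trans (n<b^n m) (ℕₚ.^-monoʳ-≤ b (m≤n⇒m≤1+n (ℕₚ.m≤n+m m e))))) (stable e)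

    module CoefficientsOf (G : Series R) where
      -- coefficient of q^n in y_i q^i G(q)
      shifted : ℕ → ℕ → Carrier
      shifted n i = sumTo R n (λ m → δ R m i * (y i * G (n ∸ m)))

      B₀-⋆ : ∀ n → (B 0 ⋆ G) n ≈ G n + sum1To R b (shifted n)
      B₀-⋆ n = begin
        sumTo R n (λ m → (δ R m 0 + sum1To R b (λ i → δ R m (i ℕ.* 1) * y i)) * G (n ∸ m))
          ≈⟨ sumTo-cong n (λ m _ → distribʳ _ _ _) ⟩
        sumTo R n (λ m → δ R m 0 * G (n ∸ m) + sum1To R b (λ i → δ R m (i ℕ.* 1) * y i) * G (n ∸ m))
          ≈⟨ sumTo-distrib-+ n _ _ ⟩
        sumTo R n (λ m → δ R m 0 * G (n ∸ m)) + sumTo R n (λ m → sum1To R b (λ i → δ R m (i ℕ.* 1) * y i) * G (n ∸ m))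
          ≈⟨ +-cong (sumTo-δ n 0 (λ m → G (n ∸ m)) z≤n) (sumTo-cong n (λ m _ → trans (*-distribʳ-sum1To b _ _)
               (sum1To-cong b (λ i _ _ → trans (*-assoc _ _ _) (*-congʳ (reflexive (≡.cong (δ R m) (ℕₚ.*-identityʳ i)))))))) ⟩
        G n + sumTo R n (λ m → sum1To R b (λ i → δ R m i * (y i * G (n ∸ m))))
          ≈⟨ +-congˡ (sumTo-sum1To-comm n b _) ⟩
        G n + sum1To R b (shifted n)
          ∎

      module _ {g : Series R} (G-dil : IsDilation G g) where
        shifted-sum : ∀ j m → 1 ≤ j → j ≤ b → sum1To R b (shifted (j ℕ.+ m ℕ.* b)) ≈ y j * g m
        shifted-sum j m 1≤j j≤b = begin
          sum1To R b (shifted n)   ≈⟨ sum1To-single b j 1≤j j≤b others ⟩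
          shifted n j              ≈⟨ sumTo-δ n j _ j≤n ⟩
          y j * G (n ∸ j)          ≈⟨ *-congˡ (reflexive (≡.cong G (ℕₚ.m+n∸m≡n j (m ℕ.* b)))) ⟩
          y j * G (m ℕ.* b)        ≈⟨ *-congˡ (proj₁ G-dil m) ⟩
          y j * g m                ∎
          where
          n = j ℕ.+ m ℕ.* b
          j≤n : j ≤ n
          j≤n = ℕₚ.m≤m+n j (m ℕ.* b)
          b∣n∸j : b ∣ n ∸ j
          b∣n∸j = ≡.subst (b ∣_) (≡.sym (ℕₚ.m+n∸m≡n j (m ℕ.* b))) (n∣m*n m)
          others : ∀ i → 1 ≤ i → i ≤ b → i ≢ j → shifted n i ≈ 0#
          others i 1≤i i≤b i≢j = sumTo-δ-zero n i _ (λ i≤n → trans (*-congˡ (proj₂ G-dil (n ∸ i)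
            (λ b∣n∸i → i≢j (∣∸-injective 1≤i i≤b 1≤j j≤b i≤n j≤n b∣n∸i b∣n∸j)))) (zeroʳ _))

        B₀-⋆-multiple : ∀ m → (B 0 ⋆ G) (m ℕ.* b) ≈ g m + y b * (q· g) m
        B₀-⋆-multiple zero = trans (B₀-⋆ 0) (+-cong (proj₁ G-dil 0) (trans
          (sum1To-zero b (λ i 1≤i _ → sumTo-δ-zero 0 i (λ m → y i * G (0 ∸ m)) (λ i≤0 → ⊥-elim (ℕₚ.<⇒≱ 1≤i i≤0))))
          (sym (zeroʳ (y b)))))
        B₀-⋆-multiple (suc m) = trans (B₀-⋆ _) (+-cong (proj₁ G-dil (suc m)) (shifted-sum b m (s≤s z≤n) ≤-refl))

        B₀-⋆-offset : ∀ j m → 1 ≤ j → j < b → (B 0 ⋆ G) (j ℕ.+ m ℕ.* b) ≈ y j * g m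
        B₀-⋆-offset j m 1≤j j<b = trans (B₀-⋆ _) (trans
          (+-cong (proj₂ G-dil _ (∤-r+q*b j m 1≤j j<b)) (shifted-sum j m 1≤j (ℕₚ.<⇒≤ j<b))) (+-identityˡ _))

    coeff : ℕ → Carrier
    coeff = p R b x y

    β : Carrier
    β = x * y (b ∸ 1) + y b

    P-stable-q· : ∀ N m → m ≤ N → (q· P N) m ≈ (q· coeff) m
    P-stable-q· N zero _ = refl
    P-stable-q· N (suc m) 1+m≤N = P-stable N m (ℕₚ.<⇒≤ 1+m≤N)

    coeff-multiple : ∀ m → coeff (suc m ℕ.* b) ≈ coeff (suc m) + β * coeff m
    coeff-multiple m = begin
      P (suc N) (suc N)
        ≈⟨ P-suc N (suc N) ⟩
      (linear x ⋆ H) (suc N)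
        ≈⟨ linear-⋆ x H (suc N) ⟩
      H (suc N) + x * H N
        ≈⟨ +-cong (B₀-⋆-multiple dil (suc m)) (*-congˡ (B₀-⋆-offset dil (suc k) m (s≤s z≤n) ≤-refl)) ⟩
      (P N (suc m) + y b * P N m) + x * (y (b ∸ 1) * P N m)
        ≈⟨ +-cong (+-cong (P-stable N (suc m) (s≤s m≤k+m*b)) (*-congˡ Pₘ)) (*-congˡ (*-congˡ Pₘ)) ⟩
      (coeff (suc m) + y b * coeff m) + x * (y (b ∸ 1) * coeff m)
        ≈⟨ solve 5 (λ c₁ yb c₀ x yb₋₁ → (c₁ :+ yb :* c₀) :+ x :* (yb₋₁ :* c₀) := c₁ :+ (x :* yb₋₁ :+ yb) :* c₀)
             refl (coeff (suc m)) (y b) (coeff m) x (y (b ∸ 1)) ⟩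
      coeff (suc m) + β * coeff m
        ∎
      where
      N = suc (k ℕ.+ m ℕ.* b)
      H = B 0 ⋆ P∘q^b N
      dil = P∘q^b-isDilation N
      open CoefficientsOf (P∘q^b N)
      m≤k+m*b : m ≤ k ℕ.+ m ℕ.* b
      m≤k+m*b = ℕₚ.≤-trans (ℕₚ.m≤m*n m b) (ℕₚ.m≤n+m (m ℕ.* b) k)
      Pₘ : P N m ≈ coeff m
      Pₘ = P-stable N m (m≤n⇒m≤1+n m≤k+m*b)

    coeff-after-multiple : ∀ m → coeff (suc (m ℕ.* b)) ≈ (x + y 1) * coeff m + x * y b * (q· coeff) m
    coeff-after-multiple m = begin
      P (suc N) (suc N)
        ≈⟨ P-suc N (suc N) ⟩
      (linear x ⋆ H) (suc N)
        ≈⟨ linear-⋆ x H (suc N) ⟩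
      H (suc N) + x * H N
        ≈⟨ +-cong (B₀-⋆-offset dil 1 m (s≤s z≤n) (s≤s (s≤s z≤n))) (*-congˡ (B₀-⋆-multiple dil m)) ⟩
      y 1 * P N m + x * (P N m + y b * (q· P N) m)
        ≈⟨ +-cong (*-congˡ Pₘ) (*-congˡ (+-cong Pₘ (*-congˡ (P-stable-q· N m m≤N)))) ⟩
      y 1 * coeff m + x * (coeff m + y b * (q· coeff) m)
        ≈⟨ solve 5 (λ y₁ c₀ x yb c₋₁ → y₁ :* c₀ :+ x :* (c₀ :+ yb :* c₋₁) := (x :+ y₁) :* c₀ :+ x :* yb :* c₋₁)
             refl (y 1) (coeff m) x (y b) ((q· coeff) m) ⟩
      (x + y 1) * coeff m + x * y b * (q· coeff) m
        ∎
      where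
      N = m ℕ.* b
      H = B 0 ⋆ P∘q^b N
      dil = P∘q^b-isDilation N
      open CoefficientsOf (P∘q^b N)
      m≤N : m ≤ N
      m≤N = ℕₚ.m≤m*n m b
      Pₘ : P N m ≈ coeff m
      Pₘ = P-stable N m m≤N

    -- (b^n - 1)/(b - 1), the base-b number written with n ones
    repunit : ℕ → ℕ
    repunit zero = 0
    repunit (suc n) = suc (repunit n ℕ.* b)

    Qᵇ : ℕ → Carrier
    Qᵇ n = coeff (repunit n ℕ.* b)

    Rᵇ : ℕ → Carrier
    Rᵇ n = coeff (repunit n)

    Qᵇ≈Rᵇ+q·Qᵇ : ∀ n → Qᵇ n ≈ Rᵇ n + β * (q· Qᵇ) n
    Qᵇ≈Rᵇ+q·Qᵇ zero = sym (trans (+-congˡ (zeroʳ _)) (+-identityʳ _))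
    Qᵇ≈Rᵇ+q·Qᵇ (suc n) = coeff-multiple (repunit n ℕ.* b)

    Rᵇ-suc : ∀ n → Rᵇ (suc n) ≈ (x + y 1) * Rᵇ n + x * y b * (q· Qᵇ) n
    Rᵇ-suc zero = coeff-after-multiple 0
    Rᵇ-suc (suc n) = coeff-after-multiple (repunit (suc n))

    coeff-zero : coeff 0 ≈ 1#
    coeff-zero = begin
      (linear x ⋆ B 0) 0    ≈⟨ linear-⋆ x (B 0) 0 ⟩
      B 0 0 + x * 0#        ≈⟨ +-cong (+-congˡ (sum1To-zero b (λ { (suc i) _ _ → δ-≢-* {0} {suc i ℕ.* 1} (λ ()) (y (suc i)) })))
                                       (zeroʳ x) ⟩
      (1# + 0#) + 0#        ≈⟨ trans (+-identityʳ _) (+-identityʳ _) ⟩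
      1#                    ∎

    Qᵇ-one : Qᵇ 1 ≈ W₁ R b x y
    Qᵇ-one = begin
      Qᵇ 1                                                     ≈⟨ Qᵇ≈Rᵇ+q·Qᵇ 1 ⟩
      Rᵇ 1 + β * Qᵇ 0                                          ≈⟨ +-congʳ (Rᵇ-suc 0) ⟩
      ((x + y 1) * Rᵇ 0 + x * y b * 0#) + β * Qᵇ 0
        ≈⟨ +-cong (+-cong (*-congˡ coeff-zero) (zeroʳ _)) (*-congˡ coeff-zero) ⟩
      ((x + y 1) * 1# + 0#) + β * 1#
        ≈⟨ solve 4 (λ x y₁ yb yb₋₁ → ((x :+ y₁) :* con 1 :+ con 0) :+ (x :* yb₋₁ :+ yb) :* con 1
                                      := x :* yb₋₁ :+ x :+ y₁ :+ yb)
             refl x (y 1) (y b) (y (b ∸ 1)) ⟩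
      W₁ R b x y                                               ∎

    Qᵇ-lucas : LucasRecurrence (W₁ R b x y) (W₂ R b x y) Qᵇ
    Qᵇ-lucas n = begin
      Qᵇ (2 ℕ.+ n) + W₂ R b x y * Qᵇ n
        ≈⟨ +-congʳ (trans (Qᵇ≈Rᵇ+q·Qᵇ (2 ℕ.+ n)) (+-congʳ (Rᵇ-suc (suc n)))) ⟩
      (((x + y 1) * Rᵇ (suc n) + x * y b * Qᵇ n) + β * Qᵇ (suc n)) + W₂ R b x y * Qᵇ n
        ≈⟨ solve 7 (λ x y₁ yb yb₋₁ r₁ q₀ q₁ →
             (((x :+ y₁) :* r₁ :+ x :* yb :* q₀) :+ (x :* yb₋₁ :+ yb) :* q₁)
               :+ (x :* x :* yb₋₁ :+ x :* y₁ :* yb₋₁ :+ y₁ :* yb) :* q₀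
             := (x :+ y₁) :* (r₁ :+ (x :* yb₋₁ :+ yb) :* q₀) :+ (x :* yb₋₁ :+ yb) :* q₁)
             refl x (y 1) (y b) (y (b ∸ 1)) (Rᵇ (suc n)) (Qᵇ n) (Qᵇ (suc n)) ⟩
      (x + y 1) * (Rᵇ (suc n) + β * Qᵇ n) + β * Qᵇ (suc n)
        ≈⟨ +-congʳ (*-congˡ (Qᵇ≈Rᵇ+q·Qᵇ (suc n))) ⟨
      (x + y 1) * Qᵇ (suc n) + β * Qᵇ (suc n)
        ≈⟨ solve 5 (λ x y₁ yb yb₋₁ q₁ → (x :+ y₁) :* q₁ :+ (x :* yb₋₁ :+ yb) :* q₁ := (x :* yb₋₁ :+ x :+ y₁ :+ yb) :* q₁)
             refl x (y 1) (y b) (y (b ∸ 1)) (Qᵇ (suc n)) ⟩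
      W₁ R b x y * Qᵇ (suc n)
        ∎

    D·half+β≈W₁·half : ∀ half → half * (1# + 1#) ≈ 1# →
                       (x + y 1 - x * y (b ∸ 1) - y b) * half + β ≈ W₁ R b x y * half
    D·half+β≈W₁·half half half-inverse = begin
      (x + y 1 - x * y (b ∸ 1) - y b) * half + β   ≈⟨ +-congʳ (*-congʳ (trans (+-assoc _ _ _) (+-congˡ (⁻¹-∙-comm _ _)))) ⟩
      (x + y 1 - β) * half + β                     ≈⟨ [a-c]·half+c≈[a+c]·half R half half-inverse (x + y 1) β ⟩
      (x + y 1 + β) * half                         ≈⟨ *-congʳ (solve 4 (λ x y₁ yb₋₁ yb → x :+ y₁ :+ (x :* yb₋₁ :+ yb)
                                                                      := x :* yb₋₁ :+ x :+ y₁ :+ yb)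
                                                        refl x (y 1) (y (b ∸ 1)) (y b)) ⟩
      W₁ R b x y * half                            ∎

    b^n≡1+repunit*[b-1] : ∀ n → b ℕ.^ n ≡ suc (repunit n ℕ.* suc k)
    b^n≡1+repunit*[b-1] zero = ≡.refl
    b^n≡1+repunit*[b-1] (suc n) = ≡.trans (≡.cong (b ℕ.*_) (b^n≡1+repunit*[b-1] n)) (lemma (repunit n) k)
      where
      lemma : ∀ r k → suc (suc k) ℕ.* suc (r ℕ.* suc k) ≡ suc (suc (r ℕ.* suc (suc k)) ℕ.* suc k)
      lemma = solve-∀

    Rb≡Rᵇ : ∀ hb n → Rb R b hb x y n ≡ Rᵇ n
    Rb≡Rᵇ hb n = ≡.cong coeff (≡.trans (≡.cong (λ m → (m ∸ 1) / suc k) (b^n≡1+repunit*[b-1] n))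
                                       (m*n/n≡m (repunit n) (suc k)))

    Q≡Qᵇ : ∀ hb n → Q R b hb x y n ≡ Qᵇ n
    Q≡Qᵇ hb n = ≡.cong coeff (≡.trans (≡.cong (_/ suc k) b^[1+n]∸b≡repunit*b*[b-1])
                                     (m*n/n≡m (repunit n ℕ.* b) (suc k)))
      where
      lemma : ∀ r k → suc (suc k) ℕ.* (r ℕ.* suc k) ≡ r ℕ.* suc (suc k) ℕ.* suc k
      lemma = solve-∀
      b^[1+n]∸b≡repunit*b*[b-1] : b ℕ.* b ℕ.^ n ∸ b ≡ repunit n ℕ.* b ℕ.* suc k
      b^[1+n]∸b≡repunit*b*[b-1] =
        ≡.trans (≡.cong (λ m → b ℕ.* m ∸ b) (b^n≡1+repunit*[b-1] n))
        (≡.trans (≡.cong (_∸ b) (ℕₚ.*-suc b (repunit n ℕ.* suc k)))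
        (≡.trans (ℕₚ.m+n∸m≡n b _) (lemma (repunit n) k)))

    Qprev≡q·Qᵇ : ∀ hb n → Qprev R b hb x y n ≡ (q· Qᵇ) n
    Qprev≡q·Qᵇ hb zero = ≡.refl
    Qprev≡q·Qᵇ hb (suc n) = Q≡Qᵇ hb n

proposition9p4 : {c ℓ : Level} (R : CommutativeRing c ℓ) →
    let open CommutativeRing R in
    (b : ℕ) (hb : 2 ≤ b) (x : Carrier) (y : ℕ → Carrier)
    (s : Carrier) → s * s ≈ W₂ R b x y →
    (half : Carrier) → half * (1# + 1#) ≈ 1# →
    (inv2s : Carrier) → inv2s * ((1# + 1#) * s) ≈ 1# →
    (n : ℕ) →
    (Q R b hb x y n ≈ pow R s n * U R n (W₁ R b x y * inv2s))
    × (Rb R b hb x y n ≈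
         pow R s n * T R n (W₁ R b x y * inv2s)
         + (x + y 1 - x * y (b ∸ 1) - y b) * half * Qprev R b hb x y n)
proposition9p4 R b@(suc (suc k)) hb@(s≤s (s≤s z≤n)) x y s s²≈W₂ half half-inverse inv2s inv2s-inverse n =
  trans (reflexive (Q≡Qᵇ hb n)) (closed-form-U n) ,
  (begin
    Rb R b hb x y n                          ≡⟨ Rb≡Rᵇ hb n ⟩
    Rᵇ n                                     ≈⟨ ∙-cancelʳ (β * q·Qᵇ) _ _ (begin
      Rᵇ n + β * q·Qᵇ                        ≈⟨ Qᵇ≈Rᵇ+q·Qᵇ n ⟨
      Qᵇ n                                   ≈⟨ closed-form-T n ⟩
      sⁿTₙ + W₁ R b x y * half * q·Qᵇ        ≈⟨ +-congˡ (*-congʳ (D·half+β≈W₁·half half half-inverse)) ⟨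
      sⁿTₙ + (D * half + β) * q·Qᵇ           ≈⟨ +-congˡ (distribʳ q·Qᵇ _ _) ⟩
      sⁿTₙ + (D * half * q·Qᵇ + β * q·Qᵇ)    ≈⟨ +-assoc _ _ _ ⟨
      sⁿTₙ + D * half * q·Qᵇ + β * q·Qᵇ      ∎) ⟩
    sⁿTₙ + D * half * q·Qᵇ                   ≡⟨ ≡.cong (λ e → sⁿTₙ + D * half * e) (Qprev≡q·Qᵇ hb n) ⟨
    sⁿTₙ + D * half * Qprev R b hb x y n     ∎)
  where
  open CommutativeRing R hiding (zero)
  open import Relation.Binary.Reasoning.Setoid setoid
  open import Algebra.Properties.Group +-group using (∙-cancelʳ)
  open PowerSeries R using (q·_)
  open Lucas R
  open GeneratingProduct.Product R k x y
  D = x + y 1 - x * y (b ∸ 1) - y b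
  q·Qᵇ = (q· Qᵇ) n
  sⁿTₙ = pow R s n * T R n (W₁ R b x y * inv2s)
  closed-form-U = lucas-closed-form-U s inv2s s²≈W₂ inv2s-inverse Qᵇ-lucas coeff-zero Qᵇ-one
  closed-form-T = lucas-closed-form-T s inv2s s²≈W₂ inv2s-inverse half half-inverse Qᵇ-lucas coeff-zero Qᵇ-one
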